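{- For every integer $n\geq 2$ we have $D_{\mathbb Z_n',\{1\}}(n)=3$.
   Context: $\mathbb Z_n=\mathbb Z/n\mathbb Z$ as a module over itself and $\mathbb Z_n'=\mathbb Z_n\setminus\{0\}$. A subsequence is a non-empty subfamily of terms in the original order. For non-empty $A,B\subseteq\mathbb Z_n$, a sequence $(x_1,\ldots,x_k)$ is an $(A,B)$-weighted zero-sum sequence if there exist $a_i\in A$, $b_i\in B$ with $\sum a_ix_i=0$ and $\sum b_ia_i=0$. $D_{A,B}(n)$ is the least positive $k$ such that every sequence in $\mathbb Z_n$ of length $k$ has an $(A,B)$-weighted zero-sum subsequence. -}

module Defs where

open import Level using (0ℓ)
open import Data.Nat using (ℕ; _*_; _≤_; _<_)
open import Data.Nat.Divisibility using (_∣_)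
open import Data.Fin using (Fin; toℕ)
open import Data.List using (List; []; zipWith; map; length)
open import Data.Nat.ListAction using (sum)
open import Data.List.Relation.Unary.All using (All)
open import Data.List.Relation.Binary.Sublist.Propositional using (_⊆_)
open import Data.Product using (Σ; _×_; ∃)
open import Relation.Nullary using (¬_)
open import Relation.Binary.PropositionalEquality using (_≡_; _≢_)
open import Relation.Unary using (Pred)

-- Elements of ℤ_n are represented by Fin n (residues 0,…,n-1).
-- A "subset" of ℤ_n is a predicate on Fin n.
Subsetℤ : ℕ → Set₁
Subsetℤ n = Pred (Fin n) 0ℓ

ℤ' : (n : ℕ) → Subsetℤ n
ℤ' n a = toℕ a ≢ 0

one : (n : ℕ) → Subsetℤ n
one n b = toℕ b ≡ 1

-- Σ_i u_i v_i computed on representatives in ℕ; it is 0 in ℤ_n iff n divides it.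
dot : {n : ℕ} → List (Fin n) → List (Fin n) → ℕ
dot us vs = sum (zipWith _*_ (map toℕ us) (map toℕ vs))

WeightedZeroSum : (n : ℕ) → Subsetℤ n → Subsetℤ n → List (Fin n) → Set
WeightedZeroSum n A B xs =
  Σ (List (Fin n)) λ as → Σ (List (Fin n)) λ bs →
    length as ≡ length xs × length bs ≡ length xs ×
    All A as × All B bs ×
    n ∣ dot as xs × n ∣ dot bs as

HasWZSSubseq : (n : ℕ) → Subsetℤ n → Subsetℤ n → List (Fin n) → Set
HasWZSSubseq n A B xs =
  Σ (List (Fin n)) λ ys → ys ⊆ xs × ys ≢ [] × WeightedZeroSum n A B ys

Good : (n : ℕ) → Subsetℤ n → Subsetℤ n → ℕ → Set
Good n A B k = (xs : List (Fin n)) → length xs ≡ k → HasWZSSubseq n A B xs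

IsD : (n : ℕ) → Subsetℤ n → Subsetℤ n → ℕ → Set
IsD n A B k = 1 ≤ k × Good n A B k × ((j : ℕ) → 1 ≤ j → j < k → ¬ Good n A B j)

-- A single term x admits no weighted zero-sum: the weight b = 1 forces the weight a ≠ 0 to vanish.
-- Likewise (0, 1) would need a₁·0 + a₂·1 = a₂ = 0, so D ≥ 3. Conversely, among three terms either
-- two coincide and (x, x) is a zero-sum with weights (1, n − 1), or they are distinct and the
-- weights (y − z, z − x, x − y) are non-zero, sum to 0, and (y − z)x + (z − x)y + (x − y)z = 0.
module Submission where

open import Defs
open import Data.Nat using (ℕ; suc; _+_; _*_; _∸_; _≤_; _<_; z≤n; s≤s; NonZero; ≢-nonZero)
open import Data.Nat.Properties
  using (+-assoc; +-identityʳ; n<1+n; *-identityˡ; *-identityʳ; *-zeroʳ; m∸n+n≡m; <⇒≤; suc-injective)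
open import Data.Nat.DivMod
  using (_%_; _mod_; m%n<n; m%n%n≡m%n; %-distribˡ-+; %-distribˡ-*; %-remove-+ˡ; [m+n]%n≡m%n; m<n⇒m%n≡m)
open import Data.Nat.Divisibility using (_∣_; _∤_; divides; >⇒∤; m%n≡0⇒n∣m; n∣m⇒m%n≡0)
open import Data.Nat.ListAction using (sum)
open import Data.Nat.Tactic.RingSolver using (solve-∀)
open import Data.Fin using (Fin; toℕ) renaming (zero to 0F; suc to sucF)
open import Data.Fin.Properties using (toℕ<n; toℕ-fromℕ<; toℕ-injective) renaming (_≟_ to _≟ᶠ_)
open import Data.List using (List; []; _∷_; length; map; zipWith)
open import Data.List.Properties using (length-map; map-∘; map-cong)
open import Data.List.Relation.Unary.All as All using (All; []; _∷_; universal)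
open import Data.List.Relation.Unary.All.Properties using (map⁺)
open import Data.List.Relation.Binary.Sublist.Propositional using ([]; _∷_; _∷ʳ_)
open import Data.Product using (_,_)
open import Function using (const; _∘_)
open import Relation.Nullary using (¬_; yes; no)
open import Relation.Binary.PropositionalEquality
  using (_≡_; _≢_; refl; sym; trans; cong; cong₂; subst; module ≡-Reasoning)

module _ {N : ℕ} .{{_ : NonZero N}} where
  open ≡-Reasoning

  %-cong-+ : ∀ {a a′ b b′} → a % N ≡ a′ % N → b % N ≡ b′ % N → (a + b) % N ≡ (a′ + b′) % N
  %-cong-+ {a} {a′} {b} {b′} a≡a′ b≡b′ = begin
    (a + b) % N             ≡⟨ %-distribˡ-+ a b N ⟩
    (a % N + b % N) % N     ≡⟨ cong₂ (λ u v → (u + v) % N) a≡a′ b≡b′ ⟩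
    (a′ % N + b′ % N) % N   ≡⟨ %-distribˡ-+ a′ b′ N ⟨
    (a′ + b′) % N           ∎

  [m%n*o]%n≡[m*o]%n : ∀ m o → (m % N * o) % N ≡ (m * o) % N
  [m%n*o]%n≡[m*o]%n m o = begin
    (m % N * o) % N           ≡⟨ %-distribˡ-* (m % N) o N ⟩
    (m % N % N * (o % N)) % N ≡⟨ cong (λ u → (u * (o % N)) % N) (m%n%n≡m%n m N) ⟩
    (m % N * (o % N)) % N     ≡⟨ %-distribˡ-* m o N ⟨
    (m * o) % N               ∎

  sum-map-% : ∀ us → sum (map (_% N) us) % N ≡ sum us % N
  sum-map-% []       = refl
  sum-map-% (u ∷ us) = %-cong-+ (m%n%n≡m%n u N) (sum-map-% us)

  sum-zipWith-%ˡ : ∀ us vs → sum (zipWith _*_ (map (_% N) us) vs) % N ≡ sum (zipWith _*_ us vs) % N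
  sum-zipWith-%ˡ []       _        = refl
  sum-zipWith-%ˡ (_ ∷ _)  []       = refl
  sum-zipWith-%ˡ (u ∷ us) (v ∷ vs) = %-cong-+ ([m%n*o]%n≡[m*o]%n u v) (sum-zipWith-%ˡ us vs)

toℕ-∤ : ∀ {n} (a : Fin n) → ℤ' n a → n ∤ toℕ a
toℕ-∤ a a≢0 = >⇒∤ {{≢-nonZero a≢0}} (toℕ<n a)

dot-1ˡ : ∀ {n} (b : Fin n) → toℕ b ≡ 1 → (as : List (Fin n)) →
         dot (map (const b) as) as ≡ sum (map toℕ as)
dot-1ˡ b b≡1 []       = refl
dot-1ˡ b b≡1 (a ∷ as) = cong₂ _+_ (trans (cong (_* toℕ a) b≡1) (*-identityˡ (toℕ a))) (dot-1ˡ b b≡1 as)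

-- With x′ = n − x etc., y + z′, z + x′, x + y′ are the weights y − z, z − x, x − y lifted to ℕ.
module _ {n : ℕ} (x y z : ℕ) {x′ y′ z′ : ℕ}
         (x′+x≡n : x′ + x ≡ n) (y′+y≡n : y′ + y ≡ n) (z′+z≡n : z′ + z ≡ n) where
  open ≡-Reasoning

  cyclic-weights-sum : y + z′ + (z + x′ + (x + y′ + 0)) ≡ 3 * n
  cyclic-weights-sum = begin
    y + z′ + (z + x′ + (x + y′ + 0)) ≡⟨ regroup x y z x′ y′ z′ ⟩
    (x′ + x) + (y′ + y) + (z′ + z)   ≡⟨ cong₂ _+_ (cong₂ _+_ x′+x≡n y′+y≡n) z′+z≡n ⟩
    n + n + n                        ≡⟨ triple n ⟩
    3 * n                            ∎
    where
    regroup : ∀ x y z x′ y′ z′ → y + z′ + (z + x′ + (x + y′ + 0)) ≡ (x′ + x) + (y′ + y) + (z′ + z)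
    regroup = solve-∀
    triple : ∀ n → n + n + n ≡ 3 * n
    triple = solve-∀

  cyclic-weights-dot : (y + z′) * x + ((z + x′) * y + ((x + y′) * z + 0)) ≡ (x + y + z) * n
  cyclic-weights-dot = begin
    (y + z′) * x + ((z + x′) * y + ((x + y′) * z + 0)) ≡⟨ regroup x y z x′ y′ z′ ⟩
    (x′ + x) * y + (y′ + y) * z + (z′ + z) * x
      ≡⟨ cong₂ _+_ (cong₂ _+_ (cong (_* y) x′+x≡n) (cong (_* z) y′+y≡n)) (cong (_* x) z′+z≡n) ⟩
    n * y + n * z + n * x                              ≡⟨ factor x y z n ⟩
    (x + y + z) * n                                    ∎
    where
    regroup : ∀ x y z x′ y′ z′ →
      (y + z′) * x + ((z + x′) * y + ((x + y′) * z + 0)) ≡ (x′ + x) * y + (y′ + y) * z + (z′ + z) * x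
    regroup = solve-∀
    factor : ∀ x y z n → n * y + n * z + n * x ≡ (x + y + z) * n
    factor = solve-∀

-- y − z in ℤ_n, lifted to ℕ so as to avoid truncated subtraction.
_⊖_ : ∀ {n} → Fin n → Fin n → ℕ
_⊖_ {n} y z = toℕ y + (n ∸ toℕ z)

∸-toℕ+toℕ : ∀ {n} (x : Fin n) → n ∸ toℕ x + toℕ x ≡ n
∸-toℕ+toℕ x = m∸n+n≡m (<⇒≤ (toℕ<n x))

∣⊖⇒≡ : ∀ {n} .{{_ : NonZero n}} {y z : Fin n} → n ∣ y ⊖ z → y ≡ z
∣⊖⇒≡ {n} {y} {z} n∣y⊖z = toℕ-injective (begin
  toℕ y                    ≡⟨ m<n⇒m%n≡m (toℕ<n y) ⟨
  toℕ y % n                ≡⟨ [m+n]%n≡m%n (toℕ y) n ⟨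
  (toℕ y + n) % n          ≡⟨ cong (λ m → (toℕ y + m) % n) (∸-toℕ+toℕ z) ⟨
  (toℕ y + (n ∸ toℕ z + toℕ z)) % n
                           ≡⟨ cong (_% n) (+-assoc (toℕ y) _ _) ⟨
  (y ⊖ z + toℕ z) % n      ≡⟨ %-remove-+ˡ (toℕ z) n∣y⊖z ⟩
  toℕ z % n                ≡⟨ m<n⇒m%n≡m (toℕ<n z) ⟩
  toℕ z                    ∎)
  where open ≡-Reasoning

singleton-¬WZS : ∀ {n} (x : Fin n) → ¬ WeightedZeroSum n (ℤ' n) (one n) (x ∷ [])
singleton-¬WZS {n} x ((a ∷ []) , (b ∷ []) , _ , _ , (a≢0 ∷ []) , (b≡1 ∷ []) , _ , n∣b*a) =
  toℕ-∤ a a≢0 (subst (n ∣_) b*a≡a n∣b*a)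
  where
  b*a≡a : toℕ b * toℕ a + 0 ≡ toℕ a
  b*a≡a = trans (+-identityʳ _) (trans (cong (_* toℕ a) b≡1) (*-identityˡ (toℕ a)))

[0,1]-¬WZS : ∀ {k} → ¬ WeightedZeroSum (suc (suc k)) (ℤ' _) (one _) (0F ∷ sucF 0F ∷ [])
[0,1]-¬WZS {k} ((a₁ ∷ a₂ ∷ []) , _ , _ , _ , (_ ∷ a₂≢0 ∷ []) , _ , n∣a·x , _) =
  toℕ-∤ a₂ a₂≢0 (subst (suc (suc k) ∣_) a·x≡a₂ n∣a·x)
  where
  a·x≡a₂ : toℕ a₁ * 0 + (toℕ a₂ * 1 + 0) ≡ toℕ a₂
  a·x≡a₂ = cong₂ _+_ (*-zeroʳ (toℕ a₁)) (trans (+-identityʳ _) (*-identityʳ (toℕ a₂)))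

Good-suc : ∀ {n A B k} → Good n A B k → Good n A B (suc k)
Good-suc good (x ∷ xs) |x∷xs|≡1+k with good xs (suc-injective |x∷xs|≡1+k)
... | ys , ys⊆xs , ys≢[] , wzs = ys , x ∷ʳ ys⊆xs , ys≢[] , wzs

¬Good-2 : ∀ k → ¬ Good (suc (suc k)) (ℤ' _) (one _) 2
¬Good-2 k good with good (0F ∷ sucF 0F ∷ []) refl
... | _ , (_ ∷ʳ _ ∷ʳ [])  , ys≢[] , _   = ys≢[] refl
... | _ , (refl ∷ _ ∷ʳ []) , _     , wzs = singleton-¬WZS _ wzs
... | _ , (_ ∷ʳ refl ∷ []) , _     , wzs = singleton-¬WZS _ wzs
... | _ , (refl ∷ refl ∷ []) , _   , wzs = [0,1]-¬WZS wzs

WZS-fromWeights : ∀ k → let n = suc (suc k) in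
  (us : List ℕ) (xs : List (Fin n)) → length us ≡ length xs → All (n ∤_) us →
  n ∣ sum (zipWith _*_ us (map toℕ xs)) → n ∣ sum us → WeightedZeroSum n (ℤ' n) (one n) xs
WZS-fromWeights k us xs |us|≡|xs| n∤us n∣u·x n∣Σu =
  as , map (const 1F) as , |as|≡|xs| , trans (length-map _ as) |as|≡|xs| ,
  map⁺ (All.map residue≢0 n∤us) , map⁺ (universal (λ _ → refl) as) , n∣a·x , n∣1·a
  where
  open ≡-Reasoning
  n = suc (suc k)
  1F : Fin n
  1F = sucF 0F
  as = map (_mod n) us
  |as|≡|xs| : length as ≡ length xs
  |as|≡|xs| = trans (length-map _ us) |us|≡|xs|
  toℕ-mod : ∀ u → toℕ (u mod n) ≡ u % n
  toℕ-mod u = toℕ-fromℕ< (m%n<n u n)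
  residue≢0 : ∀ {u} → n ∤ u → toℕ (u mod n) ≢ 0
  residue≢0 {u} n∤u u%n≡0 = n∤u (m%n≡0⇒n∣m u n (trans (sym (toℕ-mod u)) u%n≡0))
  toℕ-as : map toℕ as ≡ map (_% n) us
  toℕ-as = trans (sym (map-∘ us)) (map-cong toℕ-mod us)
  n∣a·x : n ∣ dot as xs
  n∣a·x = m%n≡0⇒n∣m _ n (begin
    sum (zipWith _*_ (map toℕ as) (map toℕ xs)) % n
      ≡⟨ cong (λ ws → sum (zipWith _*_ ws (map toℕ xs)) % n) toℕ-as ⟩
    sum (zipWith _*_ (map (_% n) us) (map toℕ xs)) % n ≡⟨ sum-zipWith-%ˡ us (map toℕ xs) ⟩
    sum (zipWith _*_ us (map toℕ xs)) % n              ≡⟨ n∣m⇒m%n≡0 _ n n∣u·x ⟩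
    0                                                  ∎)
  n∣1·a : n ∣ dot (map (const 1F) as) as
  n∣1·a = m%n≡0⇒n∣m _ n (begin
    dot (map (const 1F) as) as % n ≡⟨ cong (_% n) (dot-1ˡ 1F refl as) ⟩
    sum (map toℕ as) % n           ≡⟨ cong (λ ws → sum ws % n) toℕ-as ⟩
    sum (map (_% n) us) % n        ≡⟨ sum-map-% us ⟩
    sum us % n                     ≡⟨ n∣m⇒m%n≡0 _ n n∣Σu ⟩
    0                              ∎)

WZS-[x,x] : ∀ k (x : Fin (suc (suc k))) → WeightedZeroSum _ (ℤ' _) (one _) (x ∷ x ∷ [])
WZS-[x,x] k x = WZS-fromWeights k (1 ∷ suc k ∷ []) (x ∷ x ∷ []) refl
  (>⇒∤ (s≤s (s≤s z≤n)) ∷ >⇒∤ (n<1+n (suc k)) ∷ [])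
  (divides (toℕ x) (x+[n-1]x≡xn k (toℕ x))) (divides 1 (1+[n-1]≡1*n k))
  where
  x+[n-1]x≡xn : ∀ k x → 1 * x + (suc k * x + 0) ≡ x * suc (suc k)
  x+[n-1]x≡xn = solve-∀
  1+[n-1]≡1*n : ∀ k → 1 + (suc k + 0) ≡ 1 * suc (suc k)
  1+[n-1]≡1*n = solve-∀

WZS-distinct-[x,y,z] : ∀ k (x y z : Fin (suc (suc k))) → x ≢ y → y ≢ z → z ≢ x →
  WeightedZeroSum _ (ℤ' _) (one _) (x ∷ y ∷ z ∷ [])
WZS-distinct-[x,y,z] k x y z x≢y y≢z z≢x = WZS-fromWeights k (y ⊖ z ∷ z ⊖ x ∷ x ⊖ y ∷ []) _ refl
  (y≢z ∘ ∣⊖⇒≡ ∷ z≢x ∘ ∣⊖⇒≡ ∷ x≢y ∘ ∣⊖⇒≡ ∷ [])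
  (divides (toℕ x + toℕ y + toℕ z) (cyclic-weights-dot (toℕ x) (toℕ y) (toℕ z) x′+x y′+y z′+z))
  (divides 3 (cyclic-weights-sum (toℕ x) (toℕ y) (toℕ z) x′+x y′+y z′+z))
  where
  x′+x = ∸-toℕ+toℕ x
  y′+y = ∸-toℕ+toℕ y
  z′+z = ∸-toℕ+toℕ z

Good-3 : ∀ k → Good (suc (suc k)) (ℤ' _) (one _) 3
Good-3 k (x ∷ y ∷ z ∷ []) refl with x ≟ᶠ y | y ≟ᶠ z | z ≟ᶠ x
... | yes refl | _        | _        = _ , refl ∷ refl ∷ z ∷ʳ [] , (λ ()) , WZS-[x,x] k x
... | _        | yes refl | _        = _ , x ∷ʳ refl ∷ refl ∷ [] , (λ ()) , WZS-[x,x] k y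
... | _        | _        | yes refl = _ , refl ∷ y ∷ʳ refl ∷ [] , (λ ()) , WZS-[x,x] k z
... | no x≢y   | no y≢z   | no z≢x   =
  _ , refl ∷ refl ∷ refl ∷ [] , (λ ()) , WZS-distinct-[x,y,z] k x y z x≢y y≢z z≢x

theorem5 : (n : ℕ) → 2 ≤ n → IsD n (ℤ' n) (one n) 3
theorem5 (suc (suc k)) (s≤s (s≤s z≤n)) = s≤s z≤n , Good-3 k , not-Good-below-3
  where
  not-Good-below-3 : ∀ j → 1 ≤ j → j < 3 → ¬ Good (suc (suc k)) (ℤ' _) (one _) j
  not-Good-below-3 1 _ _ = ¬Good-2 k ∘ Good-suc
  not-Good-below-3 2 _ _ = ¬Good-2 k
  not-Good-below-3 (suc (suc (suc _))) _ (s≤s (s≤s (s≤s ())))
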